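{- If $\mathfrak A$ is a striped gridlike structure, then there exists a homomorphism from the grid $\mathfrak G$ into $\mathfrak A$ (with respect to the relations $H$ and $V$).
   Context: The grid is $\mathfrak G=(\mathbb N^2,V,H)$ with $V=\{((i,j),(i,j+1)):i,j\in\mathbb N\}$ and $H=\{((i,j),(i+1,j)):i,j\in\mathbb N\}$. A structure $\mathfrak A=(A,V,H)$ with $V,H$ binary is gridlike if (1) $V$ is serial ($\forall x\exists y\,V(x,y)$), (2) $H$ is serial, and (3) whenever $a,b,c,b',c'\in A$ satisfy $V(a,b)$, $H(b,c)$, $H(a,b')$, $V(b',c')$, then $c=c'$. A $\{V,H,U,P,Q,C\}$-structure $\mathfrak A$ ($U,P,Q,C$ unary) is striped and gridlike if its $\{V,H\}$-reduct is gridlike, the extensions of $P$ and $Q$ are distinct singletons, the extension of $U$ is the union of those of $P$ and $Q$, and for all $a,b\in A$: if $H(a,b)$ then ($C(a)\Leftrightarrow C(b)$), and if $V(a,b)$ then ($C(a)\Leftrightarrow\neg C(b)$). -}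

module Defs where

open import Level using (Level; _⊔_; suc)
open import Data.Nat using (ℕ) renaming (suc to sucℕ)
open import Data.Product using (Σ; ∃; _×_; _,_)
open import Relation.Binary.PropositionalEquality using (_≡_)
open import Relation.Nullary using (¬_)
open import Data.Sum using (_⊎_)

record Structure (a ℓ : Level) : Set (suc (a ⊔ ℓ)) where
  field
    Carrier : Set a
    V H     : Carrier → Carrier → Set ℓ
    U P Q C : Carrier → Set ℓ

GridV : ℕ × ℕ → ℕ × ℕ → Set
GridV (i , j) (i' , j') = (i' ≡ i) × (j' ≡ sucℕ j)

GridH : ℕ × ℕ → ℕ × ℕ → Set
GridH (i , j) (i' , j') = (i' ≡ sucℕ i) × (j' ≡ j)

module _ {a ℓ : Level} (𝔄 : Structure a ℓ) where
  open Structure 𝔄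

  Serial : (Carrier → Carrier → Set ℓ) → Set (a ⊔ ℓ)
  Serial R = ∀ x → ∃ λ y → R x y

  Gridlike : Set (a ⊔ ℓ)
  Gridlike = Serial V × Serial H ×
    (∀ a b c b' c' → V a b → H b c → H a b' → V b' c' → c ≡ c')

  Singleton : (Carrier → Set ℓ) → Carrier → Set (a ⊔ ℓ)
  Singleton R p = ∀ x → (R x → x ≡ p) × (x ≡ p → R x)

  StripedGridlike : Set (a ⊔ ℓ)
  StripedGridlike =
    Gridlike ×
    (Σ Carrier λ p → Σ Carrier λ q →
       Singleton P p × Singleton Q q × ¬ (p ≡ q)) ×
    (∀ x → (U x → P x ⊎ Q x) × (P x ⊎ Q x → U x)) ×
    (∀ x y → H x y → (C x → C y) × (C y → C x)) ×
    (∀ x y → V x y → (C x → ¬ C y) × (¬ C y → C x))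

  IsGridHom : (ℕ × ℕ → Carrier) → Set ℓ
  IsGridHom f =
    (∀ u v → GridV u v → V (f u) (f v)) ×
    (∀ u v → GridH u v → H (f u) (f v))

module Submission where

-- Only the gridlike part of the hypothesis matters, together with the fact
-- that the carrier is inhabited (the point marked by P provides an element).
-- Given a gridlike structure and any root x₀, we build f : ℕ² → A by
--   * walking up the first column with V-successors:  f(0,j+1) = V-succ(f(0,j)),
--   * walking along every row with H-successors:      f(i+1,j) = H-succ(f(i,j)).  For V-edges
-- we argue by induction on the column index i: the gridlike axiom (3) says
-- that a V-edge followed by H-steps closes up into a commuting square
-- ('close-square'), which carries V(f(i,j), f(i,j+1)) to column i+1.
-- The theorem follows by rooting this construction at the P-point.

open import Defs
open import Level using (Level)
open import Data.Nat using (ℕ; zero; suc)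
open import Data.Product using (Σ; _×_; _,_; proj₁; proj₂)
open import Relation.Binary.PropositionalEquality using (_≡_; refl; subst; sym)

module GridlikeHom {a ℓ : Level} (𝔄 : Structure a ℓ) (gridlike : Gridlike 𝔄) where
  open Structure 𝔄

  private
    serialV : Serial 𝔄 V
    serialV = proj₁ gridlike

    serialH : Serial 𝔄 H
    serialH = proj₁ (proj₂ gridlike)

    confluent : ∀ a b c b' c' → V a b → H b c → H a b' → V b' c' → c ≡ c'
    confluent = proj₂ (proj₂ gridlike)

  vSucc hSucc : Carrier → Carrier
  vSucc x = proj₁ (serialV x)
  hSucc x = proj₁ (serialH x)

  -- Square closing: if a →V b →H c and a →H b', then b' →V c.  The axiom
  -- identifies c with the V-successor of b', which is a V-edge from b'.
  close-square : ∀ {a b c b'} → V a b → H b c → H a b' → V b' c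
  close-square {a} {b} {c} {b'} ab bc ab' =
    subst (V b') (sym (confluent a b c b' (vSucc b') ab bc ab' b'→c')) b'→c'
    where
      b'→c' : V b' (vSucc b')
      b'→c' = proj₂ (serialV b')

  module _ (x₀ : Carrier) where

    -- The grid map rooted at x₀ (column index first, row index second).
    embed : ℕ → ℕ → Carrier
    embed zero    zero    = x₀
    embed zero    (suc j) = vSucc (embed zero j)
    embed (suc i) j       = hSucc (embed i j)

    embed-H : ∀ i j → H (embed i j) (embed (suc i) j)
    embed-H i j = proj₂ (serialH (embed i j))

    -- Vertical grid edges are V-edges: true in column 0 by construction,
    -- and transported from column i to column i+1 by square closing.
    embed-V : ∀ i j → V (embed i j) (embed i (suc j))
    embed-V zero    j = proj₂ (serialV (embed zero j))
    embed-V (suc i) j = close-square (embed-V i j) (embed-H i (suc j)) (embed-H i j)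

    grid-hom : Σ (ℕ × ℕ → Carrier) (IsGridHom 𝔄)
    grid-hom = (λ { (i , j) → embed i j })
             , (λ { (i , j) (.i , .(suc j)) (refl , refl) → embed-V i j })
             , (λ { (i , j) (.(suc i) , .j) (refl , refl) → embed-H i j })

lemma14 : {a ℓ : Level} (𝔄 : Structure a ℓ) → StripedGridlike 𝔄 →
    Σ (ℕ × ℕ → Structure.Carrier 𝔄) (IsGridHom 𝔄)
lemma14 𝔄 (gridlike , (p , _) , _) = GridlikeHom.grid-hom 𝔄 gridlike p
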